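{- Let $G$ be a simple connected graph of order $n\geq 3$, and let $V=V(G)\subseteq V(R(G))$. If $S\subseteq V$ is a differential set of $R(G)$, then there is a differential set $S'$ of $R(G)$ with $S\subseteq S'\subseteq V$ such that $S'$ is a dominating set of $G$.
   Context: $R(G)$ is the graph obtained from $G$ by adding, for each edge $e=xy\in E(G)$, a new vertex $v_e$ adjacent exactly to $x$ and $y$. For a graph $H$ and $S\subseteq V(H)$, $B_H(S)$ is the set of vertices not in $S$ adjacent to some vertex of $S$, $\partial_H(S)=|B_H(S)|-|S|$, $\partial(H)=\max_{S\subseteq V(H)}\partial_H(S)$, and $S$ is a differential set of $H$ if $\partial_H(S)=\partial(H)$. A dominating set of $G$ is a set $S$ such that every vertex of $G$ is in $S$ or adjacent in $G$ to a vertex of $S$. -}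

module Defs where

open import Data.Nat using (ℕ; _+_; _<ᵇ_)
open import Data.Fin using (Fin; toℕ; splitAt; _≟_)
open import Data.Fin.Subset using (Subset; ∣_∣; _∈_; _∉_; _⊆_)
open import Data.Bool using (Bool; true; false; _∧_; _∨_; not; if_then_else_)
open import Data.List using (List; []; _∷_; concatMap; length; allFin)
open import Data.Bool.ListAction using (any)
import Data.List as L
open import Data.Vec using (Vec; tabulate; lookup; _++_; replicate)
open import Data.Product using (_×_; _,_; proj₁; proj₂; ∃-syntax)
open import Data.Sum using (_⊎_; inj₁; inj₂)
open import Data.Integer using (ℤ; +_; _-_; _≤_)
open import Relation.Nullary.Decidable using (⌊_⌋)
open import Relation.Binary.PropositionalEquality using (_≡_)

record SimpleGraph (n : ℕ) : Set where
  field
    adj   : Fin n → Fin n → Bool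
    sym   : ∀ x y → adj x y ≡ adj y x
    loopless : ∀ x → adj x x ≡ false
open SimpleGraph public

data Walk {n : ℕ} (G : SimpleGraph n) : Fin n → Fin n → Set where
  here : ∀ {x} → Walk G x x
  step : ∀ {x y z} → adj G x y ≡ true → Walk G y z → Walk G x z

Connected : {n : ℕ} → SimpleGraph n → Set
Connected G = ∀ x y → Walk G x y

edgeList : {n : ℕ} → SimpleGraph n → List (Fin n × Fin n)
edgeList {n} G =
  concatMap (λ i → concatMap (λ j →
    if adj G i j ∧ (toℕ i <ᵇ toℕ j) then (i , j) ∷ [] else [])
    (allFin n)) (allFin n)

numEdges : {n : ℕ} → SimpleGraph n → ℕ
numEdges G = length (edgeList G)

edgeAt : {n : ℕ} (G : SimpleGraph n) → Fin (numEdges G) → Fin n × Fin n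
edgeAt G e = L.lookup (edgeList G) e

_==_ : {n : ℕ} → Fin n → Fin n → Bool
x == y = ⌊ x ≟ y ⌋

-- R(G): vertex set Fin (n + m); the first n vertices are V(G) (in order),
-- vertex n + e is the new vertex v_e for the e-th edge; v_e is adjacent
-- exactly to the two endpoints of e, and G's edges are kept.
RAdj : {n : ℕ} (G : SimpleGraph n) → Fin (n + numEdges G) → Fin (n + numEdges G) → Bool
RAdj {n} G u v with splitAt n u | splitAt n v
... | inj₁ x | inj₁ y = adj G x y
... | inj₁ x | inj₂ e = (x == proj₁ (edgeAt G e)) ∨ (x == proj₂ (edgeAt G e))
... | inj₂ e | inj₁ y = (y == proj₁ (edgeAt G e)) ∨ (y == proj₂ (edgeAt G e))
... | inj₂ _ | inj₂ _ = false

boundary : {N : ℕ} → (Fin N → Fin N → Bool) → Subset N → Subset N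
boundary {N} A S = tabulate (λ v →
  not (lookup S v) ∧ any (λ u → lookup S u ∧ A u v) (allFin N))

differential : {N : ℕ} → (Fin N → Fin N → Bool) → Subset N → ℤ
differential A S = + ∣ boundary A S ∣ - + ∣ S ∣

IsDifferentialSet : {N : ℕ} → (Fin N → Fin N → Bool) → Subset N → Set
IsDifferentialSet A S = ∀ T → differential A T ≤ differential A S

embedV : {n : ℕ} (G : SimpleGraph n) → Subset n → Subset (n + numEdges G)
embedV G S = S ++ replicate (numEdges G) false

IsDominating : {n : ℕ} → SimpleGraph n → Subset n → Set
IsDominating G S = ∀ v → v ∈ S ⊎ ∃[ u ] (u ∈ S × adj G u v ≡ true)

-- A vertex v of G that is not dominated by S ⊆ V(G) lies neither in S nor in
-- its boundary in R(G).  Adding v to S keeps the old boundary and, since v has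
-- a neighbour x (G is connected with at least two vertices), adds the
-- subdivision vertex of vx, which had no neighbour in S.  So the
-- differential does not drop, and adding undominated vertices one at a time
-- turns a differential set inside V into a dominating one.
module Submission where

open import Defs hiding (sym)
open import Data.Nat using (ℕ; zero; suc; _+_; _≥_; _≤_; _<_; _<ᵇ_; s≤s)
import Data.Nat.Properties as ℕ
open import Data.Fin using (Fin; toℕ; splitAt; _↑ˡ_; _↑ʳ_; _≟_)
import Data.Fin as Fin
import Data.Fin.Properties as Fin
open import Data.Fin.Subset using (Subset; inside; outside; _∈_; _∉_; _⊆_; _⊂_; ∣_∣)
open import Data.Fin.Subset.Properties using (_∈?_; p⊂q⇒∣p∣<∣q∣; ∣p∣≤n)
open import Data.Bool using (Bool; true; false; T; not; _∧_; _∨_; if_then_else_)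
open import Data.Bool.Properties using (T-≡; T-∧; T-∨; T-not-≡)
import Data.Bool.Properties as Bool
open import Data.Bool.ListAction using (any)
open import Data.List using (List; allFin; concatMap; []) renaming (_∷_ to _∷ₗ_)
open import Data.List.Membership.Propositional using () renaming (_∈_ to _∈ₗ_)
import Data.List.Relation.Unary.Any as Any
import Data.List.Relation.Unary.Any.Properties as Any
open import Data.List.Membership.Propositional.Properties using (∈-allFin; ∈-concatMap⁺)
open import Data.Vec using (lookup; _[_]≔_; _∷_; there)
import Data.Vec.Properties as Vec
open import Data.Integer using (+_; _-_; _⊖_) renaming (_≤_ to _≤ℤ_)
import Data.Integer.Properties as ℤ
open import Data.Product using (_×_; _,_; proj₂; ∃-syntax)
import Data.Product as Product
open import Data.Sum using (_⊎_; inj₁; inj₂)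
import Data.Sum as Sum
open import Function using (id; _∘_; _⇔_; mk⇔; Equivalence)
open import Relation.Nullary using (¬_; Dec; yes; no; contradiction)
open import Relation.Nullary.Decidable using (_⊎-dec_; _×-dec_; toWitness; fromWitness)
open import Relation.Binary.PropositionalEquality
open import Relation.Binary.Definitions using (tri<; tri≈; tri>)

open Equivalence using (to; from)

∈⇒lookup≡true : ∀ {N} {p : Subset N} {x} → x ∈ p → lookup p x ≡ true
∈⇒lookup≡true = Vec.[]=⇒lookup

lookup≡true⇒∈ : ∀ {N} {p : Subset N} {x} → lookup p x ≡ true → x ∈ p
lookup≡true⇒∈ {p = p} {x} = Vec.lookup⇒[]= x p

lookup≡false⇒∉ : ∀ {N} {p : Subset N} {x} → lookup p x ≡ false → x ∉ p
lookup≡false⇒∉ px≡false x∈p with () ← trans (sym (∈⇒lookup≡true x∈p)) px≡false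

∉⇒lookup≡false : ∀ {N} {p : Subset N} {x} → x ∉ p → lookup p x ≡ false
∉⇒lookup≡false {p = p} {x} x∉p with lookup p x in eq
... | true  = contradiction (lookup≡true⇒∈ eq) x∉p
... | false = refl

x∈p[x]≔inside : ∀ {N} (p : Subset N) x → x ∈ p [ x ]≔ inside
x∈p[x]≔inside p x = Vec.[]≔-updates p x

x∈p⇒x∈p[y]≔inside : ∀ {N} {p : Subset N} {x} y → x ∈ p → x ∈ p [ y ]≔ inside
x∈p⇒x∈p[y]≔inside {p = p} {x} y x∈p with x ≟ y
... | yes refl = x∈p[x]≔inside p x
... | no x≢y   = Vec.[]≔-minimal p x y x≢y x∈p

x∉p⇒x∉p[y]≔inside : ∀ {N} {p : Subset N} {x y} → x ≢ y → x ∉ p → x ∉ p [ y ]≔ inside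
x∉p⇒x∉p[y]≔inside {p = p} {x} {y} x≢y x∉p x∈p′ = contradiction
  (Vec.[]=-injective x∈p′ (Vec.[]≔-minimal p x y x≢y (Vec.lookup⇒[]= x p (∉⇒lookup≡false x∉p))))
  λ ()

∣p[x]≔inside∣≡1+∣p∣ : ∀ {N} {p : Subset N} {x} → x ∉ p → ∣ p [ x ]≔ inside ∣ ≡ suc ∣ p ∣
∣p[x]≔inside∣≡1+∣p∣ {p = inside  ∷ p} {Fin.zero}  x∉p = contradiction (lookup≡true⇒∈ refl) x∉p
∣p[x]≔inside∣≡1+∣p∣ {p = outside ∷ p} {Fin.zero}  _   = refl
∣p[x]≔inside∣≡1+∣p∣ {p = inside  ∷ p} {Fin.suc x} x∉p = cong suc (∣p[x]≔inside∣≡1+∣p∣ (x∉p ∘ there))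
∣p[x]≔inside∣≡1+∣p∣ {p = outside ∷ p} {Fin.suc x} x∉p = ∣p[x]≔inside∣≡1+∣p∣ (x∉p ∘ there)

any-allFin⁺ : ∀ {N} (f : Fin N → Bool) {u} → f u ≡ true → any f (allFin N) ≡ true
any-allFin⁺ {N} f fu = to T-≡ (Any.any⁺ f (Any.map (λ { refl → from T-≡ fu }) (∈-allFin _)))

any-allFin⁻ : ∀ {N} (f : Fin N → Bool) → any f (allFin N) ≡ true → ∃[ u ] f u ≡ true
any-allFin⁻ {N} f h = let (u , fu) = Any.satisfied (Any.any⁻ f (allFin N) (from T-≡ h)) in u , to T-≡ fu

+m-+n≤+o-+[1+n] : ∀ {m o} n → m < o → + m - + n ≤ℤ + o - + suc n
+m-+n≤+o-+[1+n] {m} {o} n m<o = begin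
  + m - + n       ≡⟨ ℤ.m-n≡m⊖n m n ⟩
  m ⊖ n           ≡⟨ ℤ.[1+m]⊖[1+n]≡m⊖n m n ⟨
  suc m ⊖ suc n   ≤⟨ ℤ.⊖-monoˡ-≤ (suc n) m<o ⟩
  o ⊖ suc n       ≡⟨ ℤ.m-n≡m⊖n o (suc n) ⟨
  + o - + suc n   ∎
  where open ℤ.≤-Reasoning

module _ {N : ℕ} (A : Fin N → Fin N → Bool) where

  private
    lookup-boundary : ∀ S x →
      lookup (boundary A S) x ≡ not (lookup S x) ∧ any (λ u → lookup S u ∧ A u x) (allFin N)
    lookup-boundary S x = Vec.lookup∘tabulate _ x

  ∈-boundary⁺ : ∀ {S x u} → x ∉ S → u ∈ S → A u x ≡ true → x ∈ boundary A S
  ∈-boundary⁺ {S} {x} {u} x∉S u∈S Aux = lookup≡true⇒∈ (begin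
    lookup (boundary A S) x
      ≡⟨ lookup-boundary S x ⟩
    not (lookup S x) ∧ any (λ u → lookup S u ∧ A u x) (allFin N)
      ≡⟨ cong₂ _∧_ (cong not (∉⇒lookup≡false x∉S))
                   (any-allFin⁺ (λ u → lookup S u ∧ A u x) (cong₂ _∧_ (∈⇒lookup≡true u∈S) Aux)) ⟩
    true ∎)
    where open ≡-Reasoning

  ∈-boundary⁻ : ∀ {S x} → x ∈ boundary A S → x ∉ S × ∃[ u ] (u ∈ S × A u x ≡ true)
  ∈-boundary⁻ {S} {x} x∈B
    with x∉S , anyNbr ← to T-∧ (from T-≡ (trans (sym (lookup-boundary S x)) (∈⇒lookup≡true x∈B)))
    with u , Su∧Aux ← any-allFin⁻ (λ u → lookup S u ∧ A u x) (to T-≡ anyNbr)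
    with Su , Aux ← to T-∧ (from T-≡ Su∧Aux)
    = lookup≡false⇒∉ (to T-not-≡ x∉S) , u , lookup≡true⇒∈ (to T-≡ Su) , to T-≡ Aux

  boundary⊆boundary[v]≔inside : ∀ {S v} → v ∉ boundary A S →
                                boundary A S ⊆ boundary A (S [ v ]≔ inside)
  boundary⊆boundary[v]≔inside {S} {v} v∉B {x} x∈B
    with x∉S , u , u∈S , Aux ← ∈-boundary⁻ {S} x∈B
    = ∈-boundary⁺ {S [ v ]≔ inside} (x∉p⇒x∉p[y]≔inside x≢v x∉S) (x∈p⇒x∈p[y]≔inside v u∈S) Aux
    where
    x≢v : x ≢ v
    x≢v refl = v∉B x∈B

  boundary⊂boundary[v]≔inside : ∀ {S v w} → v ∉ boundary A S →
    w ∉ S → w ≢ v → w ∉ boundary A S → A v w ≡ true →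
    boundary A S ⊂ boundary A (S [ v ]≔ inside)
  boundary⊂boundary[v]≔inside {S} {v} {w} v∉B w∉S w≢v w∉B Avw =
    boundary⊆boundary[v]≔inside {S} v∉B ,
    w , ∈-boundary⁺ {S [ v ]≔ inside} (x∉p⇒x∉p[y]≔inside w≢v w∉S) (x∈p[x]≔inside S v) Avw , w∉B

  -- |S| grows by one, while B(S) keeps all its vertices and gains w.
  differential-mono-[v]≔inside : ∀ {S v w} → v ∉ S → v ∉ boundary A S →
    w ∉ S → w ≢ v → w ∉ boundary A S → A v w ≡ true →
    differential A S ≤ℤ differential A (S [ v ]≔ inside)
  differential-mono-[v]≔inside {S} {v} v∉S v∉B w∉S w≢v w∉B Avw
    rewrite ∣p[x]≔inside∣≡1+∣p∣ v∉S
    = +m-+n≤+o-+[1+n] ∣ S ∣ (p⊂q⇒∣p∣<∣q∣ (boundary⊂boundary[v]≔inside {S} v∉B w∉S w≢v w∉B Avw))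

↑ʳ≢↑ˡ : ∀ {k l} (i : Fin l) (j : Fin k) → k ↑ʳ i ≢ j ↑ˡ l
↑ʳ≢↑ˡ {k} {l} i j eq
  with () ← trans (sym (Fin.splitAt-↑ʳ k l i)) (trans (cong (splitAt k) eq) (Fin.splitAt-↑ˡ k j l))

module _ {n : ℕ} (G : SimpleGraph n) where

  private
    m : ℕ
    m = numEdges G

  RAdj-↑ˡ-↑ˡ : ∀ x y → RAdj G (x ↑ˡ m) (y ↑ˡ m) ≡ adj G x y
  RAdj-↑ˡ-↑ˡ x y rewrite Fin.splitAt-↑ˡ n x m | Fin.splitAt-↑ˡ n y m = refl

  RAdj-↑ˡ-↑ʳ : ∀ {x e a b} → edgeAt G e ≡ (a , b) →
               RAdj G (x ↑ˡ m) (n ↑ʳ e) ≡ true ⇔ (x ≡ a ⊎ x ≡ b)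
  RAdj-↑ˡ-↑ʳ {x} {e} {a} {b} e≡ab
    rewrite Fin.splitAt-↑ˡ n x m | Fin.splitAt-↑ʳ n m e | e≡ab = mk⇔
      (Sum.map toWitness toWitness ∘ to T-∨′ ∘ from T-≡)
      (to T-≡ ∘ from T-∨′ ∘ Sum.map fromWitness fromWitness)
    where
    T-∨′ : T ((x == a) ∨ (x == b)) ⇔ (T (x == a) ⊎ T (x == b))
    T-∨′ = T-∨

  edge∈edgeList : ∀ {x y} → adj G x y ≡ true → toℕ x < toℕ y → (x , y) ∈ₗ edgeList G
  edge∈edgeList {x} {y} Axy x<y =
    ∈-concatMap⁺ row (Any.map (λ { refl →
      ∈-concatMap⁺ (entry x) (Any.map (λ { refl → x,y∈entry }) (∈-allFin y)) }) (∈-allFin x))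
    where
    entry : Fin n → Fin n → List (Fin n × Fin n)
    entry i j = if adj G i j ∧ (toℕ i <ᵇ toℕ j) then (i , j) ∷ₗ [] else []
    row : Fin n → List (Fin n × Fin n)
    row i = concatMap (entry i) (allFin n)
    x,y∈entry : (x , y) ∈ₗ entry x y
    x,y∈entry rewrite Axy | to T-≡ (ℕ.<⇒<ᵇ x<y) = Any.here refl

  ∈edgeList⇒edgeAt : ∀ {p} → p ∈ₗ edgeList G → ∃[ e ] edgeAt G e ≡ p
  ∈edgeList⇒edgeAt p∈ = Any.index p∈ , sym (Any.lookup-index p∈)

  adj⇒edgeAt : ∀ {x y} → adj G x y ≡ true →
               ∃[ e ] (edgeAt G e ≡ (x , y) ⊎ edgeAt G e ≡ (y , x))
  adj⇒edgeAt {x} {y} Axy with ℕ.<-cmp (toℕ x) (toℕ y)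
  ... | tri< x<y _ _ = Product.map₂ inj₁ (∈edgeList⇒edgeAt (edge∈edgeList Axy x<y))
  ... | tri≈ _ x≡y _ with refl ← Fin.toℕ-injective x≡y
                     = contradiction (trans (sym Axy) (loopless G x)) λ ()
  ... | tri> _ _ y<x = Product.map₂ inj₂ (∈edgeList⇒edgeAt (edge∈edgeList (trans (SimpleGraph.sym G y x) Axy) y<x))

  subdivisionVertex : ∀ {v x} → adj G v x ≡ true →
    ∃[ e ] (RAdj G (v ↑ˡ m) (n ↑ʳ e) ≡ true ×
            ∀ y → RAdj G (y ↑ˡ m) (n ↑ʳ e) ≡ true → y ≡ v ⊎ y ≡ x)
  subdivisionVertex Avx with adj⇒edgeAt Avx
  ... | e , inj₁ e≡vx = e , from (RAdj-↑ˡ-↑ʳ e≡vx) (inj₁ refl) , λ _ → to (RAdj-↑ˡ-↑ʳ e≡vx)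
  ... | e , inj₂ e≡xv = e , from (RAdj-↑ˡ-↑ʳ e≡xv) (inj₂ refl) , λ _ → Sum.swap ∘ to (RAdj-↑ˡ-↑ʳ e≡xv)

  ↑ˡ∉embedV : ∀ {S x} → x ∉ S → x ↑ˡ m ∉ embedV G S
  ↑ˡ∉embedV {S} {x} x∉S =
    lookup≡false⇒∉ (trans (Vec.lookup-++ˡ S _ x) (∉⇒lookup≡false x∉S))

  ↑ʳ∉embedV : ∀ S e → n ↑ʳ e ∉ embedV G S
  ↑ʳ∉embedV S e = lookup≡false⇒∉ (trans (Vec.lookup-++ʳ S _ e) (Vec.lookup-replicate e false))

  embedV-[v]≔inside : ∀ S v → embedV G S [ v ↑ˡ m ]≔ inside ≡ embedV G (S [ v ]≔ inside)
  embedV-[v]≔inside S v = Vec.[]≔-++-↑ˡ S _ v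

  ∈-embedV⁻ : ∀ {S u} → u ∈ embedV G S → ∃[ x ] (x ∈ S × x ↑ˡ m ≡ u)
  ∈-embedV⁻ {S} {u} u∈ with splitAt n u in eq
  ... | inj₁ x with refl ← Fin.splitAt⁻¹-↑ˡ eq =
    x , lookup≡true⇒∈ (trans (sym (Vec.lookup-++ˡ S _ x)) (∈⇒lookup≡true u∈)) , refl
  ... | inj₂ e with refl ← Fin.splitAt⁻¹-↑ʳ eq = contradiction u∈ (↑ʳ∉embedV S e)

  ∈-boundary-embedV⁻ : ∀ {S z} → z ∈ boundary (RAdj G) (embedV G S) →
                       ∃[ y ] (y ∈ S × RAdj G (y ↑ˡ m) z ≡ true)
  ∈-boundary-embedV⁻ {S} z∈B
    with _ , u , u∈ , Auz ← ∈-boundary⁻ (RAdj G) {embedV G S} z∈B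
    with y , y∈S , refl ← ∈-embedV⁻ u∈
    = y , y∈S , Auz

  Dominates : Subset n → Fin n → Set
  Dominates S v = v ∈ S ⊎ ∃[ u ] (u ∈ S × adj G u v ≡ true)

  differential-embedV-mono : ∀ {S v x} → adj G v x ≡ true → ¬ Dominates S v →
    differential (RAdj G) (embedV G S) ≤ℤ differential (RAdj G) (embedV G (S [ v ]≔ inside))
  differential-embedV-mono {S} {v} {x} Avx ¬dom
    with e , Avw , endpoints ← subdivisionVertex Avx
    = subst (λ T → differential (RAdj G) (embedV G S) ≤ℤ differential (RAdj G) T)
        (embedV-[v]≔inside S v)
        (differential-mono-[v]≔inside (RAdj G) (↑ˡ∉embedV (¬dom ∘ inj₁)) v∉B
          (↑ʳ∉embedV S e) (↑ʳ≢↑ˡ e v) w∉B Avw)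
    where
    v∉B : v ↑ˡ m ∉ boundary (RAdj G) (embedV G S)
    v∉B v∈B with y , y∈S , Ayv ← ∈-boundary-embedV⁻ v∈B =
      ¬dom (inj₂ (y , y∈S , trans (sym (RAdj-↑ˡ-↑ˡ y v)) Ayv))
    w∉B : n ↑ʳ e ∉ boundary (RAdj G) (embedV G S)
    w∉B w∈B with y , y∈S , Ayw ← ∈-boundary-embedV⁻ w∈B with endpoints y Ayw
    ... | inj₁ refl = ¬dom (inj₁ y∈S)
    ... | inj₂ refl = ¬dom (inj₂ (y , y∈S , trans (SimpleGraph.sym G y v) Avx))

  dominates? : ∀ S v → Dec (Dominates S v)
  dominates? S v = v ∈? S ⊎-dec Fin.any? (λ u → u ∈? S ×-dec adj G u v Bool.≟ true)

  extend-to-dominating : (P : Subset n → Set) →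
    (∀ {S v} → ¬ Dominates S v → P S → P (S [ v ]≔ inside)) →
    ∀ {S} → P S → ∃[ S′ ] (S ⊆ S′ × P S′ × IsDominating G S′)
  extend-to-dominating P insert-preserves {S} PS = go n S (ℕ.m≤m+n n ∣ S ∣) PS
    where
    -- The fuel k bounds the number of vertices that can still be added.
    go : ∀ k S → n ≤ k + ∣ S ∣ → P S → ∃[ S′ ] (S ⊆ S′ × P S′ × IsDominating G S′)
    go k S n≤k+∣S∣ PS with Fin.all? (dominates? S)
    ... | yes dom = S , id , PS , dom
    ... | no ¬dom with v , ¬domv ← Fin.¬∀⟶∃¬ n (Dominates S) (dominates? S) ¬dom
      with ∣p[x]≔inside∣≡1+∣p∣ {p = S} (¬domv ∘ inj₁) | k
    ... | ∣S′∣≡1+∣S∣ | zero = contradiction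
          (ℕ.≤-trans (subst (_≤ n) ∣S′∣≡1+∣S∣ (∣p∣≤n (S [ v ]≔ inside))) n≤k+∣S∣) (ℕ.n≮n ∣ S ∣)
    ... | ∣S′∣≡1+∣S∣ | suc k
      with S′ , S[v]≔inside⊆S′ , PS′ , dom ← go k (S [ v ]≔ inside)
             (subst (λ s → n ≤ k + s) (sym ∣S′∣≡1+∣S∣) (subst (n ≤_) (sym (ℕ.+-suc k ∣ S ∣)) n≤k+∣S∣))
             (insert-preserves ¬domv PS)
      = S′ , S[v]≔inside⊆S′ ∘ x∈p⇒x∈p[y]≔inside v , PS′ , dom

connected⇒neighbour : ∀ {n} (G : SimpleGraph n) → 2 ≤ n → Connected G →
                      ∀ v → ∃[ x ] adj G v x ≡ true
connected⇒neighbour {suc zero}    G (s≤s ()) _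
connected⇒neighbour {suc (suc n)} G _ connected v = first-step (connected v (other v)) (v≢other v)
  where
  other : Fin (suc (suc n)) → Fin (suc (suc n))
  other Fin.zero    = Fin.suc Fin.zero
  other (Fin.suc _) = Fin.zero
  v≢other : ∀ v → v ≢ other v
  v≢other Fin.zero    ()
  v≢other (Fin.suc _) ()
  first-step : ∀ {a b} → Walk G a b → a ≢ b → ∃[ x ] adj G a x ≡ true
  first-step here         a≢a = contradiction refl a≢a
  first-step (step Aax _) _   = _ , Aax

proposition2p4 : (n : ℕ) → n ≥ 3 → (G : SimpleGraph n) → Connected G →
    (S : Subset n) → IsDifferentialSet (RAdj G) (embedV G S) →
    ∃[ S' ] (S ⊆ S' × IsDifferentialSet (RAdj G) (embedV G S') × IsDominating G S')
proposition2p4 n n≥3 G connected S S-differential =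
  extend-to-dominating G (IsDifferentialSet (RAdj G) ∘ embedV G)
    (λ {_} {v} ¬dom S-diff T → ℤ.≤-trans (S-diff T)
       (differential-embedV-mono G (proj₂ (neighbour v)) ¬dom))
    S-differential
  where
  neighbour : ∀ v → ∃[ x ] adj G v x ≡ true
  neighbour = connected⇒neighbour G (ℕ.≤-trans (ℕ.n≤1+n 2) n≥3) connected
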